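{- Let $r \ge 2$ and let $k$ be a residue modulo $r$. Let $\mathcal{H}$ be an $n$-vertex $r$-graph containing no member of $\mathcal{C}_{\equiv k}^r\text{ - }\mathrm{hom}$ with $\delta_{r-1}(\mathcal{H}) > n/3$, and let $\chi: \vec{E}(\mathcal{H}) \to A_{\mathrm{cyc}^k}$ be an accordant oriented coloring (such a coloring exists for every $\mathcal{C}_{\equiv k}^r\text{ - }\mathrm{hom}$-free $r$-graph). If a color $\Gamma$ (one of the groups $\Gamma_1,\ldots,\Gamma_m$) is used in $\mathcal{H}$, then $\Gamma$ is conjugate in $S_r$ to $S_i \times S_{r-i}$ for some $1 \le i < r$, i.e. $\Gamma = S_I \times S_J$ (the group of permutations preserving each of $I$ and $J$) for some partition $[r] = I \sqcup J$ with $|I| = i$, $|J| = r-i$.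
   Context: An $r$-graph is an $r$-uniform hypergraph; $\delta_{r-1}(\mathcal{H})$ is the minimum number of edges containing an $(r-1)$-set of vertices. $\mathcal{C}_\ell^r$ ($\ell>r$) is the tight cycle with vertices $\{0,\ldots,\ell-1\}$ and edges $\{i,\ldots,i+r-1\}$ modulo $\ell$; $\mathcal{C}_{\equiv k}^r$ is the family of tight cycles with $\ell\equiv k\pmod r$; $\mathcal{F}\text{ - }\mathrm{hom}$ is the family of all homomorphic images of members of $\mathcal{F}$ (images $\mathcal{H}_2$ of $\mathcal{H}_1$ under edge-preserving vertex maps that are surjective on edges). An oriented edge of $\mathcal{H}$ is an ordered $r$-tuple $x_1\ldots x_r$ whose underlying set is an edge; $\vec{E}(\mathcal{H})$ is the set of oriented edges, with $S_r$ acting by $\pi(x_1\ldots x_r) = x_{\pi^{ -1}(1)}\ldots x_{\pi^{ -1}(r)}$. For a subgroup $\Gamma \le S_r$, $S_r/\Gamma$ is the set of left cosets with $S_r$ acting by left multiplication. Let $\mathrm{cyc} = (1\,2\,\cdots\,r)\in S_r$. A subgroup is $\mathrm{cyc}^k$-conjugate avoiding if it contains no conjugate of $\mathrm{cyc}^k$; let $\Gamma_1,\ldots,\Gamma_m$ be representatives of the conjugacy classes of maximal $\mathrm{cyc}^k$-conjugate avoiding subgroups of $S_r$, and $A_{\mathrm{cyc}^k} = \bigsqcup_{j=1}^m S_r/\Gamma_j$. An oriented coloring by $A_{\mathrm{cyc}^k}$ is a map $\chi:\vec{E}(\mathcal{H})\to A_{\mathrm{cyc}^k}$ with $\chi(\pi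 \vec x) = \pi\chi(\vec x)$ for all $\pi\in S_r$; it is accordant if $\chi(\vec x) = \chi(\vec x')$ whenever $\vec x,\vec x'\in\vec E(\mathcal{H})$ differ in exactly one coordinate. An edge $e$ is colored with $\Gamma_j$ if $\chi(\vec x)\in S_r/\Gamma_j$ for an (equivalently every) orientation $\vec x$ of $e$; $\Gamma_j$ is used if some edge is colored with it. -}

module Defs where

open import Level using (Level; _⊔_) renaming (suc to lsuc; zero to lzero)
open import Data.Nat using (ℕ; zero; suc; _+_; _*_; _∸_; _<_; _≤_)
open import Data.Nat.DivMod using (_mod_)
open import Data.Bool using (Bool; true; false; not; _∧_)
open import Data.Bool.Properties using () renaming (_≟_ to _≟ᵇ_)
open import Data.Fin using (Fin; toℕ)
open import Data.Fin.Properties using (any?) renaming (_≟_ to _≟ᶠ_)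
open import Data.Fin.Subset using (Subset; ⊤; ⁅_⁆; _∪_; ∣_∣; _∈_)
open import Data.Fin.Permutation using (Permutation′; _⟨$⟩ʳ_; _∘ₚ_; flip; id)
open import Data.Vec using (Vec; lookup; tabulate; toList)
open import Data.Product using (Σ; ∃; ∃-syntax; _×_; _,_; proj₁; proj₂)
open import Relation.Nullary using (¬_)
open import Relation.Nullary.Decidable using (⌊_⌋; _×-dec_)
open import Relation.Binary.PropositionalEquality using (_≡_; _≢_)
open import Function.Bundles using (_⇔_)

image : ∀ {m n} → (Fin m → Fin n) → Subset m → Subset n
image g e = tabulate λ y → ⌊ any? (λ x → (lookup e x ≟ᵇ true) ×-dec (g x ≟ᶠ y)) ⌋

⟦_⟧ : ∀ {r n} → (Fin r → Fin n) → Subset n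
⟦ x ⟧ = image x ⊤

record Graph (r n : ℕ) : Set where
  field
    edge    : Subset n → Bool
    uniform : ∀ e → edge e ≡ true → ∣ e ∣ ≡ r
open Graph public

-- the set of vertices v ∉ S with S ∪ {v} an edge; its size is the
-- number of edges containing S when |S| = r - 1
codegSet : ∀ {r n} → Graph r n → Subset n → Subset n
codegSet H S = tabulate λ v → not (lookup S v) ∧ edge H (S ∪ ⁅ v ⁆)

codeg : ∀ {r n} → Graph r n → Subset n → ℕ
codeg H S = ∣ codegSet H S ∣

MinCodegAboveThird : ∀ {r n} → Graph r n → Set
MinCodegAboveThird {r} {n} H =
  ∀ (S : Subset n) → ∣ S ∣ ≡ r ∸ 1 → n < 3 * codeg H S

addMod : ∀ {r} → Fin r → ℕ → Fin r
addMod {suc r} i k = (toℕ i + k) mod suc r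

cycleEdge : ∀ {ℓ} (r : ℕ) → Fin ℓ → Fin r → Fin ℓ
cycleEdge r i j = addMod i (toℕ j)

HomImageOfCycle : ∀ {r m} (ℓ : ℕ) → Graph r m → Set
HomImageOfCycle {r} {m} ℓ G =
  Σ (Fin ℓ → Fin m) λ f →
    (∀ (i : Fin ℓ) → edge G (image f ⟦ cycleEdge r i ⟧) ≡ true)
  × (∀ (e : Subset m) → edge G e ≡ true →
       ∃[ i ] e ≡ image f ⟦ cycleEdge r i ⟧)

Subgraph : ∀ {r m n} → Graph r m → Graph r n → Set
Subgraph {r} {m} {n} G H =
  Σ (Fin m → Fin n) λ g →
    (∀ x y → g x ≡ g y → x ≡ y)
  × (∀ (e : Subset m) → edge G e ≡ true → edge H (image g e) ≡ true)

CongMod : ∀ {r} → ℕ → Fin r → Set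
CongMod {r} ℓ k = ∃[ q ] ℓ ≡ toℕ k + q * r

CycleHomFree : ∀ {r n} → Fin r → Graph r n → Set
CycleHomFree {r} k H =
  ∀ (ℓ : ℕ) → r < ℓ → CongMod ℓ k →
  ∀ (m : ℕ) (G : Graph r m) → HomImageOfCycle ℓ G → ¬ Subgraph G H

Perm : ℕ → Set
Perm r = Permutation′ r

-- usual composition: (σ · τ)(i) = σ(τ(i))
_·_ : ∀ {r} → Perm r → Perm r → Perm r
σ · τ = τ ∘ₚ σ

_⁻¹ : ∀ {r} → Perm r → Perm r
σ ⁻¹ = flip σ

_≈ₚ_ : ∀ {r} → Perm r → Perm r → Set
σ ≈ₚ τ = ∀ i → σ ⟨$⟩ʳ i ≡ τ ⟨$⟩ʳ i

PSet : ℕ → Set₁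
PSet r = Perm r → Set

record IsSubgroup {r} (Γ : PSet r) : Set where
  field
    resp  : ∀ {σ τ} → σ ≈ₚ τ → Γ σ → Γ τ
    ε∈    : Γ id
    ·∈    : ∀ {σ τ} → Γ σ → Γ τ → Γ (σ · τ)
    ⁻¹∈   : ∀ {σ} → Γ σ → Γ (σ ⁻¹)

_⊆ₚ_ : ∀ {r} → PSet r → PSet r → Set
Γ ⊆ₚ Δ = ∀ σ → Γ σ → Δ σ

-- Γ contains no conjugate τ cyc^k τ⁻¹ of cyc^k, where cyc = (1 2 ⋯ r),
-- i.e. cyc^k(i) = i + k mod r.  The conjugate σ = τ cyc^k τ⁻¹ is characterised
-- by σ(τ(i)) = τ(i + k).
CycConjAvoiding : ∀ {r} → Fin r → PSet r → Set
CycConjAvoiding {r} k Γ =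
  ∀ (τ σ : Perm r) →
    (∀ i → σ ⟨$⟩ʳ (τ ⟨$⟩ʳ i) ≡ τ ⟨$⟩ʳ (addMod i (toℕ k))) → ¬ Γ σ

MaxCycConjAvoiding : ∀ {r} → Fin r → PSet r → Set₁
MaxCycConjAvoiding {r} k Γ =
  IsSubgroup Γ × CycConjAvoiding k Γ ×
  (∀ (Δ : PSet r) → IsSubgroup Δ → CycConjAvoiding k Δ → Γ ⊆ₚ Δ → Δ ⊆ₚ Γ)

Conjugate : ∀ {r} → PSet r → PSet r → Set
Conjugate {r} Γ Δ = ∃[ τ ] (∀ σ → Γ σ ⇔ Δ (τ · (σ · (τ ⁻¹))))

Representatives : ∀ {r} → Fin r → (m : ℕ) → (Fin m → PSet r) → Set₁
Representatives {r} k m Γs =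
    (∀ j → MaxCycConjAvoiding k (Γs j))
  × (∀ (Δ : PSet r) → MaxCycConjAvoiding k Δ → ∃[ j ] Conjugate (Γs j) Δ)
  × (∀ j j′ → Conjugate (Γs j) (Γs j′) → j ≡ j′)

OEdge : ∀ {r n} → Graph r n → Set
OEdge {r} {n} H = Σ (Vec (Fin n) r) λ x → edge H ⟦ lookup x ⟧ ≡ true

actTuple : ∀ {r n} → Perm r → Vec (Fin n) r → Vec (Fin n) r
actTuple π x = tabulate λ i → lookup x ((π ⁻¹) ⟨$⟩ʳ i)

-- the action preserves oriented edges (a proof obligation supplied by
-- the user of the colouring, so no lemma is needed here)
-- Elements of A_{cyc^k} = ⊔_j S_r/Γ_j are represented by pairs (j , σ)
-- standing for the left coset σΓ_j; two representatives are equal as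
-- cosets iff j = j′ and σ⁻¹σ′ ∈ Γ_j.
CosetRep : ℕ → ℕ → Set
CosetRep r m = Fin m × Perm r

SameCoset : ∀ {r m} → (Fin m → PSet r) → CosetRep r m → CosetRep r m → Set
SameCoset Γs (j , σ) (j′ , σ′) = j ≡ j′ × Γs j ((σ ⁻¹) · σ′)

actCoset : ∀ {r m} → Perm r → CosetRep r m → CosetRep r m
actCoset π (j , σ) = (j , π · σ)

DifferInOne : ∀ {r n} → Vec (Fin n) r → Vec (Fin n) r → Set
DifferInOne {r} x x′ =
  ∃[ i ] (lookup x i ≢ lookup x′ i × (∀ j → j ≢ i → lookup x j ≡ lookup x′ j))

record AccordantColouring {r n} (H : Graph r n) (m : ℕ) (Γs : Fin m → PSet r) : Set where
  field
    χ : (x : Vec (Fin n) r) → edge H ⟦ lookup x ⟧ ≡ true → CosetRep r m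
    equivariant : ∀ (π : Perm r) x (p : edge H ⟦ lookup x ⟧ ≡ true)
                    (q : edge H ⟦ lookup (actTuple π x) ⟧ ≡ true) →
                    SameCoset Γs (χ (actTuple π x) q) (actCoset π (χ x p))
    accordant : ∀ x x′ (p : edge H ⟦ lookup x ⟧ ≡ true)
                  (p′ : edge H ⟦ lookup x′ ⟧ ≡ true) →
                  DifferInOne x x′ → SameCoset Γs (χ x p) (χ x′ p′)

ColourUsed : ∀ {r n} {H : Graph r n} {m} {Γs : Fin m → PSet r} →
             AccordantColouring H m Γs → Fin m → Set
ColourUsed {r} {n} {H} c j =
  ∃[ x ] ∃[ p ] proj₁ (AccordantColouring.χ c x p) ≡ j

-- Γ = S_I × S_J with [r] = I ⊔ J, |I| = i, 1 ≤ i < r: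
-- Γ is exactly the set of permutations preserving I (hence also J = [r] ∖ I)
IsTwoBlockStabiliser : ∀ {r} → PSet r → Set
IsTwoBlockStabiliser {r} Γ =
  ∃[ I ] (1 ≤ ∣ I ∣ × ∣ I ∣ < r ×
          (∀ (σ : Perm r) → Γ σ ⇔ (∀ i → (i ∈ I) ⇔ (σ ⟨$⟩ʳ i ∈ I))))

{-# OPTIONS --safe #-}
-- Fix an oriented edge x whose colour is the coset σΓ.  Deleting x_a from the edge leaves an
-- (r-1)-set with more than n/3 neighbours, so for any three positions two of these
-- neighbourhoods meet.  A common neighbour v of the sets without x_a and without x_b gives a
-- walk from x to x with x_a and x_b swapped, changing one coordinate at a time and staying
-- inside edges; accordance and equivariance then put σ⁻¹ (a b) σ into Γ.  So among any three
-- points of [r] two are joined by a transposition of Γ: these transpositions split [r] into at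
-- most two classes I, J, and generate S_I × S_J ≤ Γ.  There are exactly two classes, since Γ
-- contains no conjugate of cyc^k and so is not S_r.  Every element of Γ preserves the partition
-- {I, J}; if one exchanged I and J, then |I| = |J|, and matching I with the odd positions
-- produces a conjugate of cyc^k that preserves or exchanges I and J, hence lies in Γ.
module Submission where

open import Defs
open import Data.Nat using (ℕ; _≤_)
open import Data.Fin using (Fin)

open import Data.Bool using (Bool; true; false; not; _xor_; if_then_else_)
open import Data.Bool.Properties
  using (not-involutive; ¬-not; xor-same; xor-identityʳ; xor-comm) renaming (_≟_ to _≟ᵇ_)
open import Data.Fin using (zero; suc; toℕ; punchIn; punchOut)
open import Data.Fin.Permutation
  using (_⟨$⟩ʳ_; _⟨$⟩ˡ_; inverseˡ; inverseʳ; id; permutation; transpose;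
         lift₀; remove; lift₀-remove; lift₀-transpose; lift₀-cong; lift₀-id; lift₀-comp)
open import Data.Fin.Properties
  using (any?; punchIn-punchOut; toℕ-injective; toℕ-fromℕ<; toℕ<n; toℕ≤n) renaming (_≟_ to _≟ᶠ_)
open import Data.Fin.Subset
  using (Subset; inside; outside; ⊤; ⊥; ⁅_⁆; ∁; _∪_; _∩_; _─_; _-_; ∣_∣; _∈_; _∉_; _⊆_; Nonempty; Empty)
open import Data.Fin.Subset.Properties
  using (⊆-antisym; x∈p∪q⁺; x∈p∪q⁻; x∈p∩q⁺; x∈p∩q⁻; x∈⁅x⁆; x∈⁅y⁆⇒x≡y; ∈⊤; p⊆q⇒∣p∣≤∣q∣; ∣⁅x⁆∣≡1;
         p─⊥≡p; p─q⊆p; x∈p∧x≢y⇒x∈p-y; nonempty?; Empty-unique; ∣⊥∣≡0; ∣p∣≤n; ∣∁p∣≡n∸∣p∣; ∣p∣≡n⇒p≡⊤)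
open import Data.Nat as ℕ using (zero; suc; _+_; _*_; _∸_; _<_; z≤n; s≤s)
open import Data.Nat.DivMod using (_%_; _/_; m≡m%n+[m/n]*n; %-distribˡ-+; m%n%n≡m%n; [m+n]%n≡m%n; m<n⇒m%n≡m)
import Data.Nat.Properties as ℕ
open import Algebra.Properties.CommutativeMonoid.Sum ℕ.+-0-commutativeMonoid using (sum; sum-permute)
open import Data.Product using (∃-syntax; _×_; _,_; proj₁; proj₂)
open import Data.Sum using (_⊎_; inj₁; inj₂)
open import Data.Vec using (Vec; []; _∷_; lookup; tabulate; _[_]≔_; here; there)
open import Data.Vec.Properties
  using (lookup∘tabulate; tabulate∘lookup; tabulate-cong; tabulate-∘; lookup-map; lookup-replicate;
         []=⇒lookup; lookup⇒[]=; lookup∘update; lookup∘update′)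
open import Function using (_∘_; _⇔_; mk⇔; Equivalence)
open import Function.Definitions using (Injective)
open import Relation.Binary.Definitions using (Decidable)
open import Relation.Binary.PropositionalEquality hiding (resp)
open import Relation.Nullary using (¬_; Dec; yes; no; does; contradiction)
open import Relation.Nullary.Decidable using (⌊_⌋; _×-dec_; dec-true; dec-false)

private
  variable
    m n : ℕ

-- Booleans, subsets and images of tuples

⌊⌋≡true⇔ : ∀ {A : Set} (a? : Dec A) → ⌊ a? ⌋ ≡ true ⇔ A
⌊⌋≡true⇔ (yes a) = mk⇔ (λ _ → a) (λ _ → refl)
⌊⌋≡true⇔ (no ¬a) = mk⇔ (λ ()) (λ a → contradiction a ¬a)

≡true⇔≡true⇒≡ : ∀ {x y} → (x ≡ true ⇔ y ≡ true) → x ≡ y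
≡true⇔≡true⇒≡ {false} {false} _   = refl
≡true⇔≡true⇒≡ {true}  {true}  _   = refl
≡true⇔≡true⇒≡ {true}  {false} x⇔y = sym (Equivalence.to x⇔y refl)
≡true⇔≡true⇒≡ {false} {true}  x⇔y = Equivalence.from x⇔y refl

≡⇔≡⇒≡xor : ∀ {x y} u v → (x ≡ y ⇔ u ≡ v) → x ≡ u xor (v xor y)
≡⇔≡⇒≡xor         false false x≡y⇔u≡v = Equivalence.from x≡y⇔u≡v refl
≡⇔≡⇒≡xor {y = y} true  true  x≡y⇔u≡v = trans (Equivalence.from x≡y⇔u≡v refl) (sym (not-involutive y))
≡⇔≡⇒≡xor         true  false x≡y⇔u≡v = ¬-not λ x≡y → contradiction (Equivalence.to x≡y⇔u≡v x≡y) λ ()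
≡⇔≡⇒≡xor         false true  x≡y⇔u≡v = ¬-not λ x≡y → contradiction (Equivalence.to x≡y⇔u≡v x≡y) λ ()

∈-tabulate : {f : Fin n → Bool} {i : Fin n} → i ∈ tabulate f ⇔ f i ≡ true
∈-tabulate {f = f} {i} = mk⇔
  (λ i∈ → trans (sym (lookup∘tabulate f i)) ([]=⇒lookup i∈))
  (λ fi → lookup⇒[]= i _ (trans (lookup∘tabulate f i) fi))

∈-tabulate⇔∈-tabulate : {f : Fin n → Bool} {i j : Fin n} → (i ∈ tabulate f ⇔ j ∈ tabulate f) ⇔ f i ≡ f j
∈-tabulate⇔∈-tabulate = mk⇔
  (λ i⇔j → ≡true⇔≡true⇒≡ (mk⇔ (to ∈-tabulate ∘ to i⇔j ∘ from ∈-tabulate)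
                                (to ∈-tabulate ∘ from i⇔j ∘ from ∈-tabulate)))
  (λ fi≡fj → mk⇔ (from ∈-tabulate ∘ trans (sym fi≡fj) ∘ to ∈-tabulate)
                 (from ∈-tabulate ∘ trans fi≡fj ∘ to ∈-tabulate))
  where open Equivalence

module _ (Y : Fin m → Fin n) where
  private
    hit? : (y : Fin n) → Dec (∃[ i ] (lookup ⊤ i ≡ true × Y i ≡ y))
    hit? y = any? λ i → (lookup ⊤ i ≟ᵇ true) ×-dec (Y i ≟ᶠ y)

  ∈⟦⟧⁻ : {y : Fin n} → y ∈ ⟦ Y ⟧ → ∃[ i ] Y i ≡ y
  ∈⟦⟧⁻ {y} y∈ = let i , _ , Yi≡y = Equivalence.to (⌊⌋≡true⇔ (hit? y)) (Equivalence.to ∈-tabulate y∈) in i , Yi≡y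

  ∈⟦⟧⁺ : (i : Fin m) → Y i ∈ ⟦ Y ⟧
  ∈⟦⟧⁺ i = Equivalence.from ∈-tabulate (Equivalence.from (⌊⌋≡true⇔ (hit? (Y i))) (i , lookup-replicate i true , refl))

∣p∪q∣+∣p∩q∣≡∣p∣+∣q∣ : ∀ (p q : Subset n) → ∣ p ∪ q ∣ + ∣ p ∩ q ∣ ≡ ∣ p ∣ + ∣ q ∣
∣p∪q∣+∣p∩q∣≡∣p∣+∣q∣ []            []            = refl
∣p∪q∣+∣p∩q∣≡∣p∣+∣q∣ (inside  ∷ p) (inside  ∷ q) =
  cong suc (trans (ℕ.+-suc _ _) (trans (cong suc (∣p∪q∣+∣p∩q∣≡∣p∣+∣q∣ p q)) (sym (ℕ.+-suc _ _))))
∣p∪q∣+∣p∩q∣≡∣p∣+∣q∣ (inside  ∷ p) (outside ∷ q) = cong suc (∣p∪q∣+∣p∩q∣≡∣p∣+∣q∣ p q)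
∣p∪q∣+∣p∩q∣≡∣p∣+∣q∣ (outside ∷ p) (inside  ∷ q) =
  trans (cong suc (∣p∪q∣+∣p∩q∣≡∣p∣+∣q∣ p q)) (sym (ℕ.+-suc _ _))
∣p∪q∣+∣p∩q∣≡∣p∣+∣q∣ (outside ∷ p) (outside ∷ q) = ∣p∪q∣+∣p∩q∣≡∣p∣+∣q∣ p q

∣p∪q∣≤∣p∣+∣q∣ : ∀ (p q : Subset n) → ∣ p ∪ q ∣ ≤ ∣ p ∣ + ∣ q ∣
∣p∪q∣≤∣p∣+∣q∣ p q = ℕ.≤-trans (ℕ.m≤m+n _ _) (ℕ.≤-reflexive (∣p∪q∣+∣p∩q∣≡∣p∣+∣q∣ p q))

∣p∪q∣≡∣p∣+∣q∣ : ∀ (p q : Subset n) → Empty (p ∩ q) → ∣ p ∪ q ∣ ≡ ∣ p ∣ + ∣ q ∣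
∣p∪q∣≡∣p∣+∣q∣ {n} p q p∩q=∅ = begin
  ∣ p ∪ q ∣                ≡⟨ ℕ.+-identityʳ _ ⟨
  ∣ p ∪ q ∣ + 0            ≡⟨ cong (∣ p ∪ q ∣ +_) (∣⊥∣≡0 n) ⟨
  ∣ p ∪ q ∣ + ∣ ⊥ {n} ∣    ≡⟨ cong (λ s → ∣ p ∪ q ∣ + ∣ s ∣) (Empty-unique p∩q=∅) ⟨
  ∣ p ∪ q ∣ + ∣ p ∩ q ∣    ≡⟨ ∣p∪q∣+∣p∩q∣≡∣p∣+∣q∣ p q ⟩
  ∣ p ∣ + ∣ q ∣            ∎
  where open ≡-Reasoning

x∈p⇒suc∣p-x∣≡∣p∣ : {p : Subset n} {x : Fin n} → x ∈ p → suc ∣ p - x ∣ ≡ ∣ p ∣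
x∈p⇒suc∣p-x∣≡∣p∣ {p = inside  ∷ p} here        = cong (suc ∘ ∣_∣) (p─⊥≡p p)
x∈p⇒suc∣p-x∣≡∣p∣ {p = inside  ∷ p} (there x∈p) = cong suc (x∈p⇒suc∣p-x∣≡∣p∣ x∈p)
x∈p⇒suc∣p-x∣≡∣p∣ {p = outside ∷ p} (there x∈p) = x∈p⇒suc∣p-x∣≡∣p∣ x∈p

x∈p─q⇒x∉q : ∀ (p q : Subset n) {x : Fin n} → x ∈ p ─ q → x ∉ q
x∈p─q⇒x∉q (_ ∷ p) (outside ∷ q) here       ()
x∈p─q⇒x∉q (_ ∷ p) (_       ∷ q) (there x∈) (there x∈q) = x∈p─q⇒x∉q p q x∈ x∈q

x∈p-y⁻ : ∀ (p : Subset n) {x y : Fin n} → x ∈ p - y → x ∈ p × x ≢ y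
x∈p-y⁻ p {y = y} x∈ = p─q⊆p p ⁅ y ⁆ x∈ , λ { refl → x∈p─q⇒x∉q p ⁅ y ⁆ x∈ (x∈⁅x⁆ y) }

0<∣p∣⇒∃inside : (p : Subset n) → 0 < ∣ p ∣ → ∃[ j ] lookup p j ≡ inside
0<∣p∣⇒∃inside {n} p 0<∣p∣ with nonempty? p
... | yes (j , j∈p) = j , []=⇒lookup j∈p
... | no  p=∅       = contradiction (trans (cong ∣_∣ (Empty-unique p=∅)) (∣⊥∣≡0 n)) (ℕ.>⇒≢ 0<∣p∣)

∣p∣<n⇒∃outside : (p : Subset n) → ∣ p ∣ < n → ∃[ j ] lookup p j ≡ outside
∣p∣<n⇒∃outside p ∣p∣<n
  with j , j∈∁p ← 0<∣p∣⇒∃inside (∁ p) (subst (0 <_) (sym (∣∁p∣≡n∸∣p∣ p)) (ℕ.m<n⇒0<n∸m ∣p∣<n))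
  = j , trans (sym (not-involutive _)) (cong not (trans (sym (lookup-map j not p)) j∈∁p))

three-large-subsets-meet : (p q s : Subset n) → n < 3 * ∣ p ∣ → n < 3 * ∣ q ∣ → n < 3 * ∣ s ∣ →
                           Nonempty (p ∩ q) ⊎ Nonempty (q ∩ s) ⊎ Nonempty (p ∩ s)
three-large-subsets-meet {n} p q s n<3p n<3q n<3s
  with nonempty? (p ∩ q) | nonempty? (q ∩ s) | nonempty? (p ∩ s)
... | yes p∩q≠∅ | _         | _         = inj₁ p∩q≠∅
... | no _      | yes q∩s≠∅ | _         = inj₂ (inj₁ q∩s≠∅)
... | no _      | no _      | yes p∩s≠∅ = inj₂ (inj₂ p∩s≠∅)
... | no p∩q=∅  | no q∩s=∅  | no p∩s=∅  =
  contradiction sizes≤n (sizes≰n (∣ p ∣) (∣ q ∣) (∣ s ∣) n<3p n<3q n<3s)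
  where
  p∩[q∪s]=∅ : Empty (p ∩ (q ∪ s))
  p∩[q∪s]=∅ (x , x∈) with x∈p , x∈q∪s ← x∈p∩q⁻ p (q ∪ s) x∈ | x∈p∪q⁻ q s x∈q∪s
  ... | inj₁ x∈q = p∩q=∅ (x , x∈p∩q⁺ (x∈p , x∈q))
  ... | inj₂ x∈s = p∩s=∅ (x , x∈p∩q⁺ (x∈p , x∈s))

  sizes≤n : ∣ p ∣ + (∣ q ∣ + ∣ s ∣) ≤ n
  sizes≤n = subst (_≤ n)
    (trans (∣p∪q∣≡∣p∣+∣q∣ p (q ∪ s) p∩[q∪s]=∅) (cong (∣ p ∣ +_) (∣p∪q∣≡∣p∣+∣q∣ q s q∩s=∅)))
    (∣p∣≤n (p ∪ (q ∪ s)))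

  sizes≰n : ∀ a b c → n < 3 * a → n < 3 * b → n < 3 * c → ¬ (a + (b + c) ≤ n)
  sizes≰n a b c n<3a n<3b n<3c a+b+c≤n = ℕ.<-irrefl refl (begin-strict
    3 * n                      ≡⟨ cong (λ z → n + (n + z)) (ℕ.+-identityʳ n) ⟩
    n + (n + n)                <⟨ ℕ.+-mono-< n<3a (ℕ.+-mono-< n<3b n<3c) ⟩
    3 * a + (3 * b + 3 * c)    ≡⟨ trans (ℕ.*-distribˡ-+ 3 a (b + c)) (cong (3 * a +_) (ℕ.*-distribˡ-+ 3 b c)) ⟨
    3 * (a + (b + c))          ≤⟨ ℕ.*-monoʳ-≤ 3 a+b+c≤n ⟩
    3 * n                      ∎)
    where open ℕ.≤-Reasoning

∣⟦⟧∣≤ : (Y : Fin m → Fin n) → ∣ ⟦ Y ⟧ ∣ ≤ m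
∣⟦⟧∣≤ {zero} {n} Y = ℕ.≤-trans (p⊆q⇒∣p∣≤∣q∣ ⟦Y⟧⊆⊥) (ℕ.≤-reflexive (∣⊥∣≡0 n))
  where
  ⟦Y⟧⊆⊥ : ⟦ Y ⟧ ⊆ ⊥
  ⟦Y⟧⊆⊥ y∈ with () ← ∈⟦⟧⁻ Y y∈
∣⟦⟧∣≤ {suc m} Y = begin
  ∣ ⟦ Y ⟧ ∣                         ≤⟨ p⊆q⇒∣p∣≤∣q∣ ⟦Y⟧⊆ ⟩
  ∣ ⁅ Y zero ⁆ ∪ ⟦ Y ∘ suc ⟧ ∣      ≤⟨ ∣p∪q∣≤∣p∣+∣q∣ ⁅ Y zero ⁆ ⟦ Y ∘ suc ⟧ ⟩
  ∣ ⁅ Y zero ⁆ ∣ + ∣ ⟦ Y ∘ suc ⟧ ∣  ≤⟨ ℕ.+-mono-≤ (ℕ.≤-reflexive (∣⁅x⁆∣≡1 (Y zero))) (∣⟦⟧∣≤ (Y ∘ suc)) ⟩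
  suc m                             ∎
  where
  open ℕ.≤-Reasoning
  ⟦Y⟧⊆ : ⟦ Y ⟧ ⊆ ⁅ Y zero ⁆ ∪ ⟦ Y ∘ suc ⟧
  ⟦Y⟧⊆ y∈ with ∈⟦⟧⁻ Y y∈
  ... | zero  , refl = x∈p∪q⁺ (inj₁ (x∈⁅x⁆ _))
  ... | suc i , refl = x∈p∪q⁺ (inj₂ (∈⟦⟧⁺ (Y ∘ suc) i))

∣⟦⟧∣≡⇒injective : (Y : Fin m → Fin n) → ∣ ⟦ Y ⟧ ∣ ≡ m → Injective _≡_ _≡_ Y
∣⟦⟧∣≡⇒injective {suc m} Y ∣⟦Y⟧∣≡ {a} {b} Ya≡Yb with a ≟ᶠ b
... | yes a≡b = a≡b
... | no  a≢b = contradiction (subst (_≤ m) ∣⟦Y⟧∣≡ ∣⟦Y⟧∣≤m) (ℕ.<-irrefl refl)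
  where
  ⟦Y⟧⊆ : ⟦ Y ⟧ ⊆ ⟦ Y ∘ punchIn a ⟧
  ⟦Y⟧⊆ y∈ with ∈⟦⟧⁻ Y y∈
  ... | i , refl with a ≟ᶠ i
  ...   | yes refl = subst (_∈ ⟦ Y ∘ punchIn a ⟧) (trans (cong Y (punchIn-punchOut a≢b)) (sym Ya≡Yb))
                           (∈⟦⟧⁺ _ (punchOut a≢b))
  ...   | no  a≢i  = subst (_∈ ⟦ Y ∘ punchIn a ⟧) (cong Y (punchIn-punchOut a≢i)) (∈⟦⟧⁺ _ (punchOut a≢i))
  ∣⟦Y⟧∣≤m : ∣ ⟦ Y ⟧ ∣ ≤ m
  ∣⟦Y⟧∣≤m = ℕ.≤-trans (p⊆q⇒∣p∣≤∣q∣ ⟦Y⟧⊆) (∣⟦⟧∣≤ (Y ∘ punchIn a))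

⟦⟧-cong : ∀ {m′} {Y : Fin m → Fin n} {Y′ : Fin m′ → Fin n} →
          (∀ i → ∃[ j ] Y′ j ≡ Y i) → (∀ j → ∃[ i ] Y i ≡ Y′ j) → ⟦ Y ⟧ ≡ ⟦ Y′ ⟧
⟦⟧-cong {Y = Y} {Y′} Y⊆Y′ Y′⊆Y = ⊆-antisym (covered Y Y′ Y⊆Y′) (covered Y′ Y Y′⊆Y)
  where
  covered : ∀ {k l} (Z : Fin k → Fin n) (Z′ : Fin l → Fin n) →
            (∀ i → ∃[ j ] Z′ j ≡ Z i) → ⟦ Z ⟧ ⊆ ⟦ Z′ ⟧
  covered Z Z′ Z⊆Z′ y∈ with ∈⟦⟧⁻ Z y∈
  ... | i , refl = let j , Z′j≡Zi = Z⊆Z′ i in subst (_∈ ⟦ Z′ ⟧) Z′j≡Zi (∈⟦⟧⁺ Z′ j)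

lookup-actTuple : ∀ {r} (π : Perm r) (x : Vec (Fin n) r) i → lookup (actTuple π x) i ≡ lookup x (π ⟨$⟩ˡ i)
lookup-actTuple π x = lookup∘tabulate _

⟦actTuple⟧ : ∀ {r} (π : Perm r) (x : Vec (Fin n) r) → ⟦ lookup (actTuple π x) ⟧ ≡ ⟦ lookup x ⟧
⟦actTuple⟧ π x = ⟦⟧-cong (λ i → π ⟨$⟩ˡ i , sym (lookup-actTuple π x i))
                         (λ j → π ⟨$⟩ʳ j , trans (lookup-actTuple π x _) (cong (lookup x) (inverseˡ π)))

⟦[]≔⟧ : ∀ {r} (x : Vec (Fin n) r) (a : Fin r) (v : Fin n) → Injective _≡_ _≡_ (lookup x) →
        ⟦ lookup (x [ a ]≔ v) ⟧ ≡ (⟦ lookup x ⟧ - lookup x a) ∪ ⁅ v ⁆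
⟦[]≔⟧ x a v x-injective = ⊆-antisym ⊆-rhs rhs-⊆
  where
  ⊆-rhs : ⟦ lookup (x [ a ]≔ v) ⟧ ⊆ (⟦ lookup x ⟧ - lookup x a) ∪ ⁅ v ⁆
  ⊆-rhs y∈ with ∈⟦⟧⁻ _ y∈
  ... | i , refl with a ≟ᶠ i
  ...   | yes refl = x∈p∪q⁺ (inj₂ (subst (_∈ ⁅ v ⁆) (sym (lookup∘update a x v)) (x∈⁅x⁆ v)))
  ...   | no  a≢i  = x∈p∪q⁺ (inj₁ (subst (λ z → z ∈ ⟦ lookup x ⟧ - lookup x a)
                        (sym (lookup∘update′ (a≢i ∘ sym) x v))
                        (x∈p∧x≢y⇒x∈p-y (∈⟦⟧⁺ (lookup x) i) λ xi≡xa → a≢i (sym (x-injective xi≡xa)))))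
  rhs-⊆ : (⟦ lookup x ⟧ - lookup x a) ∪ ⁅ v ⁆ ⊆ ⟦ lookup (x [ a ]≔ v) ⟧
  rhs-⊆ {y} y∈ with x∈p∪q⁻ _ _ y∈
  ... | inj₂ y∈⁅v⁆ = subst (_∈ ⟦ lookup (x [ a ]≔ v) ⟧)
                       (trans (lookup∘update a x v) (sym (x∈⁅y⁆⇒x≡y v y∈⁅v⁆))) (∈⟦⟧⁺ _ a)
  ... | inj₁ y∈⟦x⟧-xa with x∈p-y⁻ ⟦ lookup x ⟧ y∈⟦x⟧-xa
  ...   | y∈⟦x⟧ , y≢xa with ∈⟦⟧⁻ _ y∈⟦x⟧
  ...     | i , refl = subst (_∈ ⟦ lookup (x [ a ]≔ v) ⟧) (lookup∘update′ (a≢i ∘ sym) x v) (∈⟦⟧⁺ _ i)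
    where
    a≢i : a ≢ i
    a≢i refl = y≢xa refl

-- Transpositions and the subgroups they generate

⟨$⟩ʳ-injective : (ρ : Perm n) {a b : Fin n} → ρ ⟨$⟩ʳ a ≡ ρ ⟨$⟩ʳ b → a ≡ b
⟨$⟩ʳ-injective ρ ρa≡ρb = trans (sym (inverseˡ ρ)) (trans (cong (ρ ⟨$⟩ˡ_) ρa≡ρb) (inverseˡ ρ))

transpose-at-i : (i j : Fin n) → transpose i j ⟨$⟩ʳ i ≡ j
transpose-at-i i j rewrite dec-true (i ≟ᶠ i) refl = refl

transpose-at-j : (i j : Fin n) → transpose i j ⟨$⟩ʳ j ≡ i
transpose-at-j i j with j ≟ᶠ i
... | yes j≡i = j≡i
... | no  _   rewrite dec-true (j ≟ᶠ j) refl = refl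

transpose-elsewhere : {i j k : Fin n} → k ≢ i → k ≢ j → transpose i j ⟨$⟩ʳ k ≡ k
transpose-elsewhere {i = i} {j} {k} k≢i k≢j rewrite dec-false (k ≟ᶠ i) k≢i | dec-false (k ≟ᶠ j) k≢j = refl

transpose-unique : {i j : Fin n} (f : Fin n → Fin n) → f i ≡ j → f j ≡ i → (∀ k → k ≢ i → k ≢ j → f k ≡ k) →
                   ∀ k → transpose i j ⟨$⟩ʳ k ≡ f k
transpose-unique {i = i} {j} f fi≡j fj≡i f-elsewhere k = by-cases (k ≟ᶠ i) (k ≟ᶠ j)
  where
  by-cases : Dec (k ≡ i) → Dec (k ≡ j) → transpose i j ⟨$⟩ʳ k ≡ f k
  by-cases (yes refl) _          = trans (transpose-at-i i j) (sym fi≡j)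
  by-cases (no  _)    (yes refl) = trans (transpose-at-j i j) (sym fj≡i)
  by-cases (no  k≢i)  (no  k≢j)  = trans (transpose-elsewhere k≢i k≢j) (sym (f-elsewhere k k≢i k≢j))

transpose-conj : (ρ : Perm n) (a b : Fin n) →
                 ∀ k → (ρ · (transpose a b · (ρ ⁻¹))) ⟨$⟩ʳ k ≡ transpose (ρ ⟨$⟩ʳ a) (ρ ⟨$⟩ʳ b) ⟨$⟩ʳ k
transpose-conj ρ a b k = sym (transpose-unique conjugate at-ρa at-ρb elsewhere k)
  where
  conjugate : Fin _ → Fin _
  conjugate k = ρ ⟨$⟩ʳ (transpose a b ⟨$⟩ʳ (ρ ⟨$⟩ˡ k))
  at-ρa : conjugate (ρ ⟨$⟩ʳ a) ≡ ρ ⟨$⟩ʳ b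
  at-ρa = trans (cong (λ k → ρ ⟨$⟩ʳ (transpose a b ⟨$⟩ʳ k)) (inverseˡ ρ)) (cong (ρ ⟨$⟩ʳ_) (transpose-at-i a b))
  at-ρb : conjugate (ρ ⟨$⟩ʳ b) ≡ ρ ⟨$⟩ʳ a
  at-ρb = trans (cong (λ k → ρ ⟨$⟩ʳ (transpose a b ⟨$⟩ʳ k)) (inverseˡ ρ)) (cong (ρ ⟨$⟩ʳ_) (transpose-at-j a b))
  elsewhere : ∀ k → k ≢ ρ ⟨$⟩ʳ a → k ≢ ρ ⟨$⟩ʳ b → conjugate k ≡ k
  elsewhere k k≢ρa k≢ρb = trans (cong (ρ ⟨$⟩ʳ_) (transpose-elsewhere (moved k≢ρa) (moved k≢ρb))) (inverseʳ ρ)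
    where
    moved : ∀ {c} → k ≢ ρ ⟨$⟩ʳ c → ρ ⟨$⟩ˡ k ≢ c
    moved k≢ρc refl = k≢ρc (sym (inverseʳ ρ))

module TranspositionRelation {n} {Γ : PSet n} (Γ-sub : IsSubgroup Γ) where
  open IsSubgroup Γ-sub

  infix 4 _∼_
  _∼_ : Fin n → Fin n → Set
  a ∼ b = Γ (transpose a b)

  ∼-refl : ∀ a → a ∼ a
  ∼-refl a = resp (λ k → sym (transpose-unique (λ k → k) refl refl (λ _ _ _ → refl) k)) ε∈

  ∼-sym : ∀ {a b} → a ∼ b → b ∼ a
  ∼-sym {a} {b} = resp λ k → sym (transpose-unique (transpose a b ⟨$⟩ʳ_) (transpose-at-j a b) (transpose-at-i a b)
                                     (λ k k≢b k≢a → transpose-elsewhere k≢a k≢b) k)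

  ∼-conj : ∀ {ρ a b} → Γ ρ → a ∼ b → ρ ⟨$⟩ʳ a ∼ ρ ⟨$⟩ʳ b
  ∼-conj {ρ} {a} {b} ρ∈Γ a∼b = resp (transpose-conj ρ a b) (·∈ ρ∈Γ (·∈ a∼b (⁻¹∈ ρ∈Γ)))

  ∼-trans : ∀ {a b c} → a ∼ b → b ∼ c → a ∼ c
  ∼-trans {a} {b} {c} a∼b b∼c with b ≟ᶠ a | b ≟ᶠ c | c ≟ᶠ a
  ... | yes refl | _        | _        = b∼c
  ... | no  _    | yes refl | _        = a∼b
  ... | no  _    | no  _    | yes refl = ∼-refl c
  ... | no  b≢a  | no  b≢c  | no  c≢a  =
    subst₂ _∼_ (transpose-at-j a b) (transpose-elsewhere c≢a (b≢c ∘ sym)) (∼-conj a∼b b∼c)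

  MovesWithinClasses : Perm n → Set
  MovesWithinClasses ρ = ∀ a → a ∼ ρ ⟨$⟩ʳ a

  MovesWithinClasses-fix : ∀ {ρ} → MovesWithinClasses ρ → ∀ s → MovesWithinClasses (transpose s (ρ ⟨$⟩ʳ s) · ρ)
  MovesWithinClasses-fix {ρ} a∼ρa s a = by-cases (ρ ⟨$⟩ʳ a ≟ᶠ s) (ρ ⟨$⟩ʳ a ≟ᶠ ρ ⟨$⟩ʳ s)
    where
    τ = transpose s (ρ ⟨$⟩ʳ s)
    by-cases : Dec (ρ ⟨$⟩ʳ a ≡ s) → Dec (ρ ⟨$⟩ʳ a ≡ ρ ⟨$⟩ʳ s) → a ∼ τ ⟨$⟩ʳ (ρ ⟨$⟩ʳ a)
    by-cases (yes ρa≡s) _          = subst (a ∼_) (sym (trans (cong (τ ⟨$⟩ʳ_) ρa≡s) (transpose-at-i s (ρ ⟨$⟩ʳ s))))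
                                       (∼-trans (subst (a ∼_) ρa≡s (a∼ρa a)) (a∼ρa s))
    by-cases (no  _)    (yes ρa≡ρs) = subst (a ∼_) (trans (⟨$⟩ʳ-injective ρ ρa≡ρs)
                                        (sym (trans (cong (τ ⟨$⟩ʳ_) ρa≡ρs) (transpose-at-j s (ρ ⟨$⟩ʳ s))))) (∼-refl a)
    by-cases (no  ρa≢s) (no  ρa≢ρs) = subst (a ∼_) (sym (transpose-elsewhere ρa≢s ρa≢ρs)) (a∼ρa a)

lift₀-subgroup : ∀ {n} {Γ : PSet (suc n)} → IsSubgroup Γ → IsSubgroup (Γ ∘ lift₀)
lift₀-subgroup Γ-sub = record
  { resp = λ {σ} {τ} σ≈τ → resp (lift₀-cong σ τ σ≈τ)
  ; ε∈   = resp (λ i → sym (lift₀-id i)) ε∈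
  ; ·∈   = λ {σ} {τ} σ∈ τ∈ → resp (lift₀-comp τ σ) (·∈ σ∈ τ∈)
  ; ⁻¹∈  = λ σ∈ → resp (λ { zero → refl ; (suc i) → refl }) (⁻¹∈ σ∈)
  }
  where open IsSubgroup Γ-sub

-- ρ′ = (0 ρ(0)) ρ fixes 0, hence is lifted from S_{n-1}; induct with the subgroup of S_{n-1}
-- that lifts into Γ.
transpositions-generate : ∀ {n} {Γ : PSet n} (Γ-sub : IsSubgroup Γ) (ρ : Perm n) →
                          TranspositionRelation.MovesWithinClasses Γ-sub ρ → Γ ρ
transpositions-generate {zero} Γ-sub ρ _ = IsSubgroup.resp Γ-sub (λ ()) (IsSubgroup.ε∈ Γ-sub)
transpositions-generate {suc n} {Γ} Γ-sub ρ a∼ρa = resp (λ i → inverseˡ τ) (·∈ (⁻¹∈ (a∼ρa zero)) ρ′∈Γ)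
  where
  open IsSubgroup Γ-sub
  open TranspositionRelation Γ-sub
  τ = transpose zero (ρ ⟨$⟩ʳ zero)
  ρ′ = τ · ρ
  ρ′-fixes-0 : ρ′ ⟨$⟩ʳ zero ≡ zero
  ρ′-fixes-0 = transpose-at-j zero (ρ ⟨$⟩ʳ zero)
  ρ′∈Γ : Γ ρ′
  ρ′∈Γ = resp (lift₀-remove ρ′ ρ′-fixes-0) (transpositions-generate (lift₀-subgroup Γ-sub) (remove zero ρ′) λ a →
           resp (lift₀-transpose a (remove zero ρ′ ⟨$⟩ʳ a))
             (subst (suc a ∼_) (sym (lift₀-remove ρ′ ρ′-fixes-0 (suc a))) (MovesWithinClasses-fix {ρ} a∼ρa zero (suc a))))

-- Rotations, parity and matchings of subsets

[m%n+o]%n≡[m+o]%n : ∀ m o n .{{_ : ℕ.NonZero n}} → (m % n + o) % n ≡ (m + o) % n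
[m%n+o]%n≡[m+o]%n m o n = begin
  (m % n + o) % n          ≡⟨ %-distribˡ-+ (m % n) o n ⟩
  (m % n % n + o % n) % n  ≡⟨ cong (λ z → (z + o % n) % n) (m%n%n≡m%n m n) ⟩
  (m % n + o % n) % n      ≡⟨ %-distribˡ-+ m o n ⟨
  (m + o) % n              ∎
  where open ≡-Reasoning

toℕ-addMod : ∀ {r} (i : Fin (suc r)) a → toℕ (addMod i a) ≡ (toℕ i + a) % suc r
toℕ-addMod i a = toℕ-fromℕ< _

addMod-addMod : ∀ {r} (i : Fin (suc r)) a b → addMod (addMod i a) b ≡ addMod i (a + b)
addMod-addMod {r} i a b = toℕ-injective (begin
  toℕ (addMod (addMod i a) b)  ≡⟨ toℕ-addMod (addMod i a) b ⟩
  (toℕ (addMod i a) + b) % R   ≡⟨ cong (λ z → (z + b) % R) (toℕ-addMod i a) ⟩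
  ((toℕ i + a) % R + b) % R    ≡⟨ [m%n+o]%n≡[m+o]%n (toℕ i + a) b R ⟩
  (toℕ i + a + b) % R          ≡⟨ cong (_% R) (ℕ.+-assoc (toℕ i) a b) ⟩
  (toℕ i + (a + b)) % R        ≡⟨ toℕ-addMod i (a + b) ⟨
  toℕ (addMod i (a + b))       ∎)
  where
  open ≡-Reasoning
  R = suc r

addMod-identity : ∀ {r} (i : Fin (suc r)) → addMod i (suc r) ≡ i
addMod-identity {r} i = toℕ-injective (begin
  toℕ (addMod i (suc r))       ≡⟨ toℕ-addMod i (suc r) ⟩
  (toℕ i + suc r) % suc r      ≡⟨ [m+n]%n≡m%n (toℕ i) (suc r) ⟩
  toℕ i % suc r                ≡⟨ m<n⇒m%n≡m (toℕ<n i) ⟩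
  toℕ i                        ∎)
  where open ≡-Reasoning

rotation : ∀ {r} → Fin r → Perm r
rotation {suc r} k = permutation (λ i → addMod i (toℕ k)) (λ i → addMod i (suc r ∸ toℕ k))
  (λ i → trans (addMod-addMod i _ _) (trans (cong (addMod i) (ℕ.m∸n+n≡m (toℕ≤n k))) (addMod-identity i)))
  (λ i → trans (addMod-addMod i _ _) (trans (cong (addMod i) (ℕ.m+[n∸m]≡n (toℕ≤n k))) (addMod-identity i)))

odd : ℕ → Bool
odd zero          = false
odd (suc zero)    = true
odd (suc (suc n)) = odd n

odd-suc : ∀ n → odd (suc n) ≡ not (odd n)
odd-suc zero          = refl
odd-suc (suc zero)    = refl
odd-suc (suc (suc n)) = odd-suc n

odd-+ : ∀ m n → odd (m + n) ≡ odd m xor odd n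
odd-+ zero          n = refl
odd-+ (suc zero)    n = odd-suc n
odd-+ (suc (suc m)) n = odd-+ m n

odd-n+n : ∀ n → odd (n + n) ≡ false
odd-n+n n = trans (odd-+ n n) (xor-same (odd n))

odd-%-even : ∀ m {R} h .{{_ : ℕ.NonZero R}} → R ≡ h + h → odd (m % R) ≡ odd m
odd-%-even m {R} h R≡h+h = sym (begin
  odd m                                 ≡⟨ cong odd (m≡m%n+[m/n]*n m R) ⟩
  odd (m % R + q * R)                   ≡⟨ cong (λ z → odd (m % R + z)) (trans (cong (q *_) R≡h+h) (ℕ.*-distribˡ-+ q h h)) ⟩
  odd (m % R + (q * h + q * h))         ≡⟨ odd-+ (m % R) (q * h + q * h) ⟩
  odd (m % R) xor odd (q * h + q * h)   ≡⟨ cong (odd (m % R) xor_) (odd-n+n (q * h)) ⟩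
  odd (m % R) xor false                 ≡⟨ xor-identityʳ _ ⟩
  odd (m % R)                           ∎)
  where
  open ≡-Reasoning
  q = m / R

odd-addMod : ∀ {r} h (i : Fin (suc r)) a → suc r ≡ h + h → odd (toℕ (addMod i a)) ≡ odd a xor odd (toℕ i)
odd-addMod h i a r≡h+h = begin
  odd (toℕ (addMod i a))   ≡⟨ cong odd (toℕ-addMod i a) ⟩
  odd ((toℕ i + a) % _)    ≡⟨ odd-%-even (toℕ i + a) h r≡h+h ⟩
  odd (toℕ i + a)          ≡⟨ odd-+ (toℕ i) a ⟩
  odd (toℕ i) xor odd a    ≡⟨ xor-comm (odd (toℕ i)) (odd a) ⟩
  odd a xor odd (toℕ i)    ∎
  where open ≡-Reasoning

odds : ∀ n → Subset n
odds n = tabulate (odd ∘ toℕ)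

∣odds∣ : ∀ n → ∣ odds n ∣ ≡ ℕ.⌊ n /2⌋
∣odds∣ zero          = refl
∣odds∣ (suc zero)    = refl
∣odds∣ (suc (suc n)) = cong suc (∣odds∣ n)

preimage : Perm n → Subset n → Subset n
preimage π p = tabulate λ i → lookup p (π ⟨$⟩ʳ i)

∣tabulate∣≡sum : (f : Fin n → Bool) → ∣ tabulate f ∣ ≡ sum (λ i → if f i then 1 else 0)
∣tabulate∣≡sum {zero}  f = refl
∣tabulate∣≡sum {suc n} f with f zero
... | true  = cong suc (∣tabulate∣≡sum (f ∘ suc))
... | false = ∣tabulate∣≡sum (f ∘ suc)

∣preimage∣ : (π : Perm n) (p : Subset n) → ∣ preimage π p ∣ ≡ ∣ p ∣
∣preimage∣ π p = begin
  ∣ preimage π p ∣                    ≡⟨ ∣tabulate∣≡sum (λ i → lookup p (π ⟨$⟩ʳ i)) ⟩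
  sum (λ i → indicator (π ⟨$⟩ʳ i))    ≡⟨ sum-permute indicator π ⟨
  sum indicator                       ≡⟨ ∣tabulate∣≡sum (lookup p) ⟨
  ∣ tabulate (lookup p) ∣             ≡⟨ cong ∣_∣ (tabulate∘lookup p) ⟩
  ∣ p ∣                               ∎
  where
  open ≡-Reasoning
  indicator : Fin _ → ℕ
  indicator i = if lookup p i then 1 else 0

-- Move to the front a position j of q holding the first entry of p, then match the tails.
∣p∣≡∣q∣⇒matching : (p q : Subset n) → ∣ p ∣ ≡ ∣ q ∣ → ∃[ π ] ∀ i → lookup q (π ⟨$⟩ʳ i) ≡ lookup p i
∣p∣≡∣q∣⇒matching []      []  _ = id , λ ()
∣p∣≡∣q∣⇒matching {suc n} (s ∷ p) q ∣s∷p∣≡∣q∣ = τ · lift₀ π , λ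
  { zero    → q[j]≡s
  ; (suc i) → trans (sym (lookup∘tabulate _ (π ⟨$⟩ʳ i))) (proj₂ tails-matched i)
  }
  where
  position-of : ∀ s → ∣ s ∷ p ∣ ≡ ∣ q ∣ → ∃[ j ] lookup q j ≡ s
  position-of inside  ∣s∷p∣≡∣q∣ = 0<∣p∣⇒∃inside q (subst (0 <_) ∣s∷p∣≡∣q∣ (s≤s z≤n))
  position-of outside ∣s∷p∣≡∣q∣ = ∣p∣<n⇒∃outside q (subst (_< suc n) ∣s∷p∣≡∣q∣ (s≤s (∣p∣≤n p)))
  j = proj₁ (position-of s ∣s∷p∣≡∣q∣)
  q[j]≡s = proj₂ (position-of s ∣s∷p∣≡∣q∣)
  τ = transpose zero j
  q′ : Subset n
  q′ = tabulate λ i → lookup q (τ ⟨$⟩ʳ suc i)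
  ∣s∷q′∣≡∣q∣ : ∣ s ∷ q′ ∣ ≡ ∣ q ∣
  ∣s∷q′∣≡∣q∣ = trans (cong (λ t → ∣ t ∷ q′ ∣) (trans (sym q[j]≡s) (cong (lookup q) (sym (transpose-at-i zero j)))))
                     (∣preimage∣ τ q)
  ∷-cancel : ∀ s {p q : Subset n} → ∣ s ∷ p ∣ ≡ ∣ s ∷ q ∣ → ∣ p ∣ ≡ ∣ q ∣
  ∷-cancel inside  = ℕ.suc-injective
  ∷-cancel outside = λ eq → eq
  tails-matched = ∣p∣≡∣q∣⇒matching p q′ (∷-cancel s {p} {q′} (trans ∣s∷p∣≡∣q∣ (sym ∣s∷q′∣≡∣q∣)))
  π = proj₁ tails-matched

-- ρ exchanges I and its complement, so |I| = r/2 and I can be matched with the odd positions;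
-- conjugating the rotation by k along this matching moves I onto itself or onto its complement
-- according to the parity of k.
swappable⇒conjugate-rotation-shifts-by-parity :
  ∀ {r} (side : Fin (suc r) → Bool) (ρ : Perm (suc r)) → (∀ i → side (ρ ⟨$⟩ʳ i) ≡ not (side i)) →
  (k : Fin (suc r)) → ∃[ τ ] ∃[ σ ] (∀ i → σ ⟨$⟩ʳ (τ ⟨$⟩ʳ i) ≡ τ ⟨$⟩ʳ addMod i (toℕ k))
                                  × (∀ i → side (σ ⟨$⟩ʳ i) ≡ odd (toℕ k) xor side i)
swappable⇒conjugate-rotation-shifts-by-parity {r} side ρ ρ-swaps k = π ⁻¹ , σ , σ-conj , σ-shifts
  where
  I = tabulate side
  h = ∣ I ∣
  ∣I∣≡∣∁I∣ : h ≡ ∣ ∁ I ∣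
  ∣I∣≡∣∁I∣ = begin
    h                             ≡⟨ ∣preimage∣ ρ I ⟨
    ∣ preimage ρ I ∣              ≡⟨ cong ∣_∣ (tabulate-cong λ i → trans (lookup∘tabulate side _) (ρ-swaps i)) ⟩
    ∣ tabulate (not ∘ side) ∣     ≡⟨ cong ∣_∣ (tabulate-∘ not side) ⟩
    ∣ ∁ I ∣                       ∎
    where open ≡-Reasoning
  r≡h+h : suc r ≡ h + h
  r≡h+h = trans (sym (ℕ.m∸n+n≡m (∣p∣≤n I))) (cong (_+ h) (sym (trans ∣I∣≡∣∁I∣ (∣∁p∣≡n∸∣p∣ I))))
  ∣I∣≡∣odds∣ : h ≡ ∣ odds (suc r) ∣
  ∣I∣≡∣odds∣ = trans (ℕ.n≡⌊n+n/2⌋ h) (sym (trans (∣odds∣ (suc r)) (cong ℕ.⌊_/2⌋ r≡h+h)))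
  matched = ∣p∣≡∣q∣⇒matching I (odds (suc r)) ∣I∣≡∣odds∣
  π = proj₁ matched
  π-matches : ∀ i → odd (toℕ (π ⟨$⟩ʳ i)) ≡ side i
  π-matches i = trans (sym (lookup∘tabulate (odd ∘ toℕ) (π ⟨$⟩ʳ i))) (trans (proj₂ matched i) (lookup∘tabulate side i))
  σ = (π ⁻¹) · (rotation k · π)
  σ-conj : ∀ i → σ ⟨$⟩ʳ (π ⟨$⟩ˡ i) ≡ π ⟨$⟩ˡ addMod i (toℕ k)
  σ-conj i = cong (λ j → π ⟨$⟩ˡ addMod j (toℕ k)) (inverseʳ π {i})
  σ-shifts : ∀ i → side (σ ⟨$⟩ʳ i) ≡ odd (toℕ k) xor side i
  σ-shifts i = begin
    side (σ ⟨$⟩ʳ i)                          ≡⟨ π-matches (σ ⟨$⟩ʳ i) ⟨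
    odd (toℕ (π ⟨$⟩ʳ (σ ⟨$⟩ʳ i)))            ≡⟨ cong (odd ∘ toℕ) (inverseʳ π {addMod (π ⟨$⟩ʳ i) (toℕ k)}) ⟩
    odd (toℕ (addMod (π ⟨$⟩ʳ i) (toℕ k)))    ≡⟨ odd-addMod h (π ⟨$⟩ʳ i) (toℕ k) r≡h+h ⟩
    odd (toℕ k) xor odd (toℕ (π ⟨$⟩ʳ i))     ≡⟨ cong (odd (toℕ k) xor_) (π-matches i) ⟩
    odd (toℕ k) xor side i                    ∎
    where open ≡-Reasoning

-- Subgroups whose transpositions have two classes

module TwoSided {n} {Γ : PSet n} (Γ-sub : IsSubgroup Γ) (side : Fin n → Bool)
                (∼⇔side≡ : ∀ {a b} → Γ (transpose a b) ⇔ side a ≡ side b) where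
  open IsSubgroup Γ-sub
  open TranspositionRelation Γ-sub

  Shifts : Bool → Perm n → Set
  Shifts c ρ = ∀ i → side (ρ ⟨$⟩ʳ i) ≡ c xor side i

  preserving⇒∈Γ : ∀ {ρ} → Shifts false ρ → Γ ρ
  preserving⇒∈Γ {ρ} ρ-preserves = transpositions-generate Γ-sub ρ λ a → Equivalence.from ∼⇔side≡ (sym (ρ-preserves a))

  ∈Γ⇒shifts : ∀ {ρ} → Γ ρ → Fin n → ∃[ c ] Shifts c ρ
  ∈Γ⇒shifts {ρ} ρ∈Γ o = side o xor side (ρ ⟨$⟩ʳ o) , λ i →
    trans (≡⇔≡⇒≡xor (side i) (side o) (mk⇔ (reflect i) (preserve i))) (xor-comm (side i) _)
    where
    preserve : ∀ i → side i ≡ side o → side (ρ ⟨$⟩ʳ i) ≡ side (ρ ⟨$⟩ʳ o)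
    preserve i = Equivalence.to ∼⇔side≡ ∘ ∼-conj ρ∈Γ ∘ Equivalence.from ∼⇔side≡
    reflect : ∀ i → side (ρ ⟨$⟩ʳ i) ≡ side (ρ ⟨$⟩ʳ o) → side i ≡ side o
    reflect i = Equivalence.to ∼⇔side≡ ∘ subst₂ _∼_ (inverseˡ ρ) (inverseˡ ρ) ∘ ∼-conj (⁻¹∈ ρ∈Γ)
              ∘ Equivalence.from ∼⇔side≡

  swapping∈Γ⇒shifts⊆Γ : ∀ {ρ θ c} → Γ ρ → Shifts true ρ → Shifts c θ → Γ θ
  swapping∈Γ⇒shifts⊆Γ {c = false} _ _ θ-preserves = preserving⇒∈Γ θ-preserves
  swapping∈Γ⇒shifts⊆Γ {ρ} {θ} {true} ρ∈Γ ρ-swaps θ-swaps =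
    resp (λ i → inverseˡ ρ) (·∈ (⁻¹∈ ρ∈Γ) (preserving⇒∈Γ {ρ · θ} λ i →
      trans (ρ-swaps (θ ⟨$⟩ʳ i)) (trans (cong not (θ-swaps i)) (not-involutive (side i)))))

module TranspositionInEveryTriple {r} (k : Fin (suc r)) {Γ : PSet (suc r)}
         (Γ-sub : IsSubgroup Γ) (Γ-avoids : CycConjAvoiding k Γ)
         {R : Fin (suc r) → Fin (suc r) → Set} (R? : Decidable R) (R⇒∼ : ∀ {a b} → R a b → Γ (transpose a b))
         (R-triangle : ∀ a b c → R a b ⊎ R b c ⊎ R a c) where
  open Equivalence
  open IsSubgroup Γ-sub
  open TranspositionRelation Γ-sub

  not-all-transpositions : ¬ (∀ a → zero ∼ a)
  not-all-transpositions 0∼ = Γ-avoids id (rotation k) (λ i → refl)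
    (transpositions-generate Γ-sub (rotation k) λ a → ∼-trans (∼-sym (0∼ a)) (0∼ (rotation k ⟨$⟩ʳ a)))

  -- The class of 0 under ∼, computed through R since membership in Γ is not decidable.
  side : Fin (suc r) → Bool
  side a = does (R? zero a)

  side≡true⇔ : ∀ {a} → side a ≡ true ⇔ zero ∼ a
  side≡true⇔ {a} with R? zero a
  ... | yes R0a = mk⇔ (λ _ → R⇒∼ R0a) (λ _ → refl)
  ... | no ¬R0a = mk⇔ (λ ()) λ 0∼a → contradiction (λ c → joined 0∼a c (R-triangle zero a c)) not-all-transpositions
    where
    joined : zero ∼ a → ∀ c → R zero a ⊎ R a c ⊎ R zero c → zero ∼ c
    joined _   c (inj₁ R0a)        = contradiction R0a ¬R0a
    joined 0∼a c (inj₂ (inj₁ Rac)) = ∼-trans 0∼a (R⇒∼ Rac)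
    joined _   c (inj₂ (inj₂ R0c)) = R⇒∼ R0c

  false-sides-joined : ∀ {a b} → side a ≡ false → side b ≡ false → a ∼ b
  false-sides-joined {a} {b} sa≡false sb≡false with R-triangle zero a b
  ... | inj₁ R0a        = contradiction (trans (sym (dec-true (R? zero a) R0a)) sa≡false) λ ()
  ... | inj₂ (inj₁ Rab) = R⇒∼ Rab
  ... | inj₂ (inj₂ R0b) = contradiction (trans (sym (dec-true (R? zero b) R0b)) sb≡false) λ ()

  ∼⇔side≡ : ∀ {a b} → a ∼ b ⇔ side a ≡ side b
  ∼⇔side≡ {a} {b} = mk⇔
    (λ a∼b → ≡true⇔≡true⇒≡ (mk⇔ (λ sa → from side≡true⇔ (∼-trans (to side≡true⇔ sa) a∼b))
                                 (λ sb → from side≡true⇔ (∼-trans (to side≡true⇔ sb) (∼-sym a∼b)))))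
    (λ sa≡sb → same-side (side a) refl (sym sa≡sb))
    where
    same-side : ∀ s → side a ≡ s → side b ≡ s → a ∼ b
    same-side true  sa sb = ∼-trans (∼-sym (to side≡true⇔ sa)) (to side≡true⇔ sb)
    same-side false sa sb = false-sides-joined sa sb

  open TwoSided Γ-sub side ∼⇔side≡

  no-swapping : ∀ {ρ} → Γ ρ → ¬ Shifts true ρ
  no-swapping {ρ} ρ∈Γ ρ-swaps =
    let τ , σ , σ-conj , σ-shifts = swappable⇒conjugate-rotation-shifts-by-parity side ρ ρ-swaps k
    in Γ-avoids τ σ σ-conj (swapping∈Γ⇒shifts⊆Γ {c = odd (toℕ k)} ρ∈Γ ρ-swaps σ-shifts)

  Γ⇔preserving : ∀ {ρ} → Γ ρ ⇔ Shifts false ρ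
  Γ⇔preserving = mk⇔ preserves preserving⇒∈Γ
    where
    preserves : ∀ {ρ} → Γ ρ → Shifts false ρ
    preserves ρ∈Γ with ∈Γ⇒shifts ρ∈Γ zero
    ... | false , ρ-preserves = ρ-preserves
    ... | true  , ρ-swaps     = contradiction ρ-swaps (no-swapping ρ∈Γ)

  I : Subset (suc r)
  I = tabulate side

  1≤∣I∣ : 1 ≤ ∣ I ∣
  1≤∣I∣ = subst (1 ≤_) (x∈p⇒suc∣p-x∣≡∣p∣ (from (∈-tabulate {f = side}) (from side≡true⇔ (∼-refl zero))))
                (s≤s z≤n)

  ∣I∣≢r : ∣ I ∣ ≢ suc r
  ∣I∣≢r ∣I∣≡r = not-all-transpositions λ a →
    to side≡true⇔ (to (∈-tabulate {f = side}) (subst (a ∈_) (sym (∣p∣≡n⇒p≡⊤ ∣I∣≡r)) ∈⊤))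

  two-block-stabiliser : IsTwoBlockStabiliser Γ
  two-block-stabiliser = I , 1≤∣I∣ , ℕ.≤∧≢⇒< (∣p∣≤n I) ∣I∣≢r , λ σ →
    mk⇔ (λ σ∈Γ i → from (∈-tabulate⇔∈-tabulate {f = side}) (sym (to Γ⇔preserving σ∈Γ i)))
        (λ σ-stabilises → from Γ⇔preserving λ i → sym (to (∈-tabulate⇔∈-tabulate {f = side}) (σ-stabilises i)))

-- Links of an edge and accordant colourings

∈codegSet⁻ : ∀ {r} (H : Graph r n) (S : Subset n) {v : Fin n} →
             v ∈ codegSet H S → v ∉ S × edge H (S ∪ ⁅ v ⁆) ≡ true
∈codegSet⁻ H S {v} v∈ with lookup S v in S[v] | Equivalence.to ∈-tabulate v∈
... | false | S∪v-edge = (λ v∈S → contradiction (trans (sym ([]=⇒lookup v∈S)) S[v]) λ ()) , S∪v-edge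

module EdgeLinks {r} (H : Graph r n) (x : Vec (Fin n) r) (x-edge : edge H ⟦ lookup x ⟧ ≡ true) where
  X = lookup x

  X-injective : Injective _≡_ _≡_ X
  X-injective = ∣⟦⟧∣≡⇒injective X (uniform H ⟦ X ⟧ x-edge)

  link : Fin r → Subset n
  link a = ⟦ X ⟧ - X a

  ∣link∣ : ∀ a → ∣ link a ∣ ≡ r ∸ 1
  ∣link∣ a = cong (_∸ 1) (trans (x∈p⇒suc∣p-x∣≡∣p∣ (∈⟦⟧⁺ X a)) (uniform H ⟦ X ⟧ x-edge))

  X∈link : ∀ {a i} → i ≢ a → X i ∈ link a
  X∈link i≢a = x∈p∧x≢y⇒x∈p-y (∈⟦⟧⁺ X _) (i≢a ∘ X-injective)

  N : Fin r → Subset n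
  N a = codegSet H (link a)

  N-large : MinCodegAboveThird H → ∀ a → n < 3 * ∣ N a ∣
  N-large δ>n/3 a = δ>n/3 (link a) (∣link∣ a)

  N-outside-edge : ∀ {a b v} → a ≢ b → v ∈ N a → v ∈ N b → ∀ i → X i ≢ v
  N-outside-edge {a} {b} a≢b v∈Na v∈Nb i Xi≡v with i ≟ᶠ a
  ... | yes refl = proj₁ (∈codegSet⁻ H (link b) v∈Nb) (subst (_∈ link b) Xi≡v (X∈link a≢b))
  ... | no  i≢a  = proj₁ (∈codegSet⁻ H (link a) v∈Na) (subst (_∈ link a) Xi≡v (X∈link i≢a))

SameCoset-trans : ∀ {r m} {Γs : Fin m → PSet r} → (∀ j → IsSubgroup (Γs j)) →
                  ∀ {u w t} → SameCoset Γs u w → SameCoset Γs w t → SameCoset Γs u t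
SameCoset-trans Γs-sub {j , σ} {_ , σ′} {_ , σ″} (refl , σ⁻¹σ′∈Γ) (refl , σ′⁻¹σ″∈Γ) =
  refl , resp (λ i → cong (σ ⟨$⟩ˡ_) (inverseʳ σ′)) (·∈ σ⁻¹σ′∈Γ σ′⁻¹σ″∈Γ)
  where open IsSubgroup (Γs-sub j)

module _ {r m} {H : Graph r n} {Γs : Fin m → PSet r} (Γs-sub : ∀ j → IsSubgroup (Γs j))
         (c : AccordantColouring H m Γs) (x : Vec (Fin n) r) (x-edge : edge H ⟦ lookup x ⟧ ≡ true) where
  open AccordantColouring c
  open EdgeLinks H x x-edge

  -- The walk x → x[a ≔ v] → (τ x)[a ≔ v] → τ x changes one coordinate at a time; its middle
  -- tuples span link a ∪ {v} and link b ∪ {v}, which are edges because v ∈ N a ∩ N b.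
  common-neighbour⇒swap-keeps-colour : ∀ {a b} → a ≢ b → Nonempty (N a ∩ N b) →
                                       SameCoset Γs (χ x x-edge) (actCoset (transpose a b) (χ x x-edge))
  common-neighbour⇒swap-keeps-colour {a} {b} a≢b (v , v∈Na∩Nb) =
    via x x₁ x-edge x₁-edge x≁x₁ (via x₁ x₂ x₁-edge x₂-edge x₁≁x₂ (via x₂ x₃ x₂-edge x₃-edge x₂≁x₃
      (equivariant τ x x-edge x₃-edge)))
    where
    v∈Na = proj₁ (x∈p∩q⁻ (N a) (N b) v∈Na∩Nb)
    v∈Nb = proj₂ (x∈p∩q⁻ (N a) (N b) v∈Na∩Nb)
    X≢v = N-outside-edge a≢b v∈Na v∈Nb
    τ = transpose a b
    x₁ x₂ x₃ : Vec (Fin n) r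
    x₁ = x [ a ]≔ v
    x₃ = actTuple τ x
    x₂ = x₃ [ a ]≔ v

    via : ∀ y y′ (y-edge : edge H ⟦ lookup y ⟧ ≡ true) (y′-edge : edge H ⟦ lookup y′ ⟧ ≡ true) →
          DifferInOne y y′ → SameCoset Γs (χ y′ y′-edge) (actCoset τ (χ x x-edge)) →
          SameCoset Γs (χ y y-edge) (actCoset τ (χ x x-edge))
    via y y′ y-edge y′-edge y≁y′ = SameCoset-trans Γs-sub {χ y y-edge} {χ y′ y′-edge} {actCoset τ (χ x x-edge)}
                                     (accordant y y′ y-edge y′-edge y≁y′)

    x₃[_] : ∀ i → lookup x₃ i ≡ X (transpose b a ⟨$⟩ʳ i)
    x₃[ i ] = lookup-actTuple τ x i
    x₃a≡Xb : lookup x₃ a ≡ X b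
    x₃a≡Xb = trans x₃[ a ] (cong X (transpose-at-j b a))
    x₃-injective : Injective _≡_ _≡_ (lookup x₃)
    x₃-injective {i} {j} x₃i≡x₃j =
      ⟨$⟩ʳ-injective (transpose b a) (X-injective (trans (sym x₃[ i ]) (trans x₃i≡x₃j x₃[ j ])))

    x₁-edge : edge H ⟦ lookup x₁ ⟧ ≡ true
    x₁-edge = subst (λ S → edge H S ≡ true) (sym (⟦[]≔⟧ x a v X-injective)) (proj₂ (∈codegSet⁻ H (link a) v∈Na))
    x₂-edge : edge H ⟦ lookup x₂ ⟧ ≡ true
    x₂-edge = subst (λ S → edge H S ≡ true)
                (sym (trans (⟦[]≔⟧ x₃ a v x₃-injective) (cong₂ (λ S y → (S - y) ∪ ⁅ v ⁆) (⟦actTuple⟧ τ x) x₃a≡Xb)))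
                (proj₂ (∈codegSet⁻ H (link b) v∈Nb))
    x₃-edge : edge H ⟦ lookup x₃ ⟧ ≡ true
    x₃-edge = subst (λ S → edge H S ≡ true) (sym (⟦actTuple⟧ τ x)) x-edge

    x≁x₁ : DifferInOne x x₁
    x≁x₁ = a , (λ Xa≡x₁a → X≢v a (trans Xa≡x₁a (lookup∘update a x v))) , λ j j≢a → sym (lookup∘update′ j≢a x v)
    x₁≁x₂ : DifferInOne x₁ x₂
    x₁≁x₂ = b , (λ x₁b≡x₂b → a≢b (sym (X-injective (trans (sym x₁[b]) (trans x₁b≡x₂b x₂[b]))))) , agree
      where
      x₁[b] : lookup x₁ b ≡ X b
      x₁[b] = lookup∘update′ (a≢b ∘ sym) x v
      x₂[b] : lookup x₂ b ≡ X a
      x₂[b] = trans (lookup∘update′ (a≢b ∘ sym) x₃ v) (trans x₃[ b ] (cong X (transpose-at-i b a)))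
      agree : ∀ j → j ≢ b → lookup x₁ j ≡ lookup x₂ j
      agree j j≢b with j ≟ᶠ a
      ... | yes refl = trans (lookup∘update a x v) (sym (lookup∘update a x₃ v))
      ... | no  j≢a  = trans (lookup∘update′ j≢a x v) (sym (trans (lookup∘update′ j≢a x₃ v)
                         (trans x₃[ j ] (cong X (transpose-elsewhere j≢b j≢a)))))
    x₂≁x₃ : DifferInOne x₂ x₃
    x₂≁x₃ = a , (λ x₂a≡x₃a → X≢v b (trans (sym x₃a≡Xb) (trans (sym x₂a≡x₃a) (lookup∘update a x₃ v))))
              , λ j j≢a → lookup∘update′ j≢a x₃ v

lemma8 : ∀ (r : ℕ) → 2 ≤ r → (k : Fin r) →
         ∀ (n : ℕ) (H : Graph r n) → CycleHomFree k H → MinCodegAboveThird H →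
         ∀ (m : ℕ) (Γs : Fin m → PSet r) → Representatives k m Γs →
         ∀ (c : AccordantColouring H m Γs) (j : Fin m) → ColourUsed c j →
         IsTwoBlockStabiliser (Γs j)
lemma8 (suc r) _ k n H _ δ>n/3 _ Γs (Γs-max , _) c _ (x , x-edge , refl) =
  TranspositionInEveryTriple.two-block-stabiliser k (Γs-sub j) (proj₁ (proj₂ (Γs-max j)))
    (λ a b → nonempty? (meet a b)) meet⇒∼ meet-in-every-triple
  where
  open AccordantColouring c
  open EdgeLinks H x x-edge
  Γs-sub : ∀ j → IsSubgroup (Γs j)
  Γs-sub j = proj₁ (Γs-max j)
  j = proj₁ (χ x x-edge)
  σ = proj₂ (χ x x-edge)
  open TranspositionRelation (Γs-sub j)

  meet : Fin (suc r) → Fin (suc r) → Subset n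
  meet a b = N (σ ⟨$⟩ʳ a) ∩ N (σ ⟨$⟩ʳ b)

  meet⇒∼ : ∀ {a b} → Nonempty (meet a b) → a ∼ b
  meet⇒∼ {a} {b} meet≠∅ with a ≟ᶠ b
  ... | yes refl = ∼-refl a
  ... | no  a≢b  = IsSubgroup.resp (Γs-sub j) conjugated
                     (proj₂ (common-neighbour⇒swap-keeps-colour Γs-sub c x x-edge (a≢b ∘ ⟨$⟩ʳ-injective σ) meet≠∅))
    where
    conjugated : ∀ i → ((σ ⁻¹) · (transpose (σ ⟨$⟩ʳ a) (σ ⟨$⟩ʳ b) · σ)) ⟨$⟩ʳ i ≡ transpose a b ⟨$⟩ʳ i
    conjugated i = trans (transpose-conj (σ ⁻¹) (σ ⟨$⟩ʳ a) (σ ⟨$⟩ʳ b) i)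
                         (cong₂ (λ a b → transpose a b ⟨$⟩ʳ i) (inverseˡ σ) (inverseˡ σ))

  meet-in-every-triple : ∀ a b c → Nonempty (meet a b) ⊎ Nonempty (meet b c) ⊎ Nonempty (meet a c)
  meet-in-every-triple a b c = three-large-subsets-meet (N (σ ⟨$⟩ʳ a)) (N (σ ⟨$⟩ʳ b)) (N (σ ⟨$⟩ʳ c))
                                 (N-large δ>n/3 _) (N-large δ>n/3 _) (N-large δ>n/3 _)
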